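{- Let $\alpha\in\mathcal{C}_n$, $i\in[n-1]$ and $z\in[n-i-\alpha_i]$. Then $\alpha$ is $(i,z)$-insertable if and only if $\alpha^*$ is $(i,z)$-removable.
   Context: $[n]=\{1,\dots,n\}$. A (weak) composition is a finite sequence of nonnegative integers $(\alpha_1,\dots,\alpha_m)$ with $\alpha_k=0$ for $k>m$; $|\alpha|=\sum\alpha_k$. $\mathcal{C}_n$ is the set of compositions $(\alpha_1,\dots,\alpha_{n-1})$ with $0\leqslant\alpha_i\leqslant n-i$. For $\alpha\in\mathcal{C}_n$, $\alpha^*\in\mathcal{C}_n$ is defined by $\alpha^*_i=n-i-\alpha_i$. For a composition $\alpha$, a positive integer $i$ and $j\in\mathbb{N}$: $c_{i,j}(\alpha)=0$ if $j\leqslant i+1$; for $j>i+1$, $c_{i,j}(\alpha)=c_{i,j-1}(\alpha)+1$ if $\alpha_{j-1}<\alpha_i-c_{i,j-1}(\alpha)$ and $c_{i,j}(\alpha)=c_{i,j-1}(\alpha)$ otherwise. For compositions with $|\alpha|=|\alpha'|+1$, $\alpha$ covers $\alpha'$ if there are positive integers $i<j$ with: (a1) $\alpha'_i\leqslant\alpha_i-1$; (a2) $\alpha'_j=\alpha_j+\alpha_i-\alpha'_i-1$; (a3) $\alpha'_k=\alpha_k$ for $k\neq i,j$; (a4) $c_{i,j}(\alpha)=c_{i,j}(\alpha')=\alpha'_i-\alpha_j$. For $\beta\in\mathcal{C}_n$, $i\in[n-1]$, $z\in[\beta_i]$: $\beta$ is $(i,z)$-removable if there exists a composition $\beta'$ with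 $\beta$ covering $\beta'$ and $\beta'_i=\beta_i-z$. For $\alpha\in\mathcal{C}_n$, $i\in[n-1]$, $z\in[n-i-\alpha_i]$: $\alpha$ is $(i,z)$-insertable if there exists $\alpha''\in\mathcal{C}_n$ with $\alpha''_i=\alpha_i+z$ such that $\alpha''$ covers $\alpha$. -}

module Defs where

open import Data.Nat using (ℕ; zero; suc; _+_; _∸_; _≤_; _<_; _<?_; _≤?_)
open import Data.List using (List; []; _∷_; map; length; upTo)
open import Data.Nat.ListAction using (sum)
open import Data.Product using (Σ; ∃; _×_; _,_)
open import Relation.Nullary using (¬_; does)
open import Relation.Binary.PropositionalEquality using (_≡_)
open import Data.Bool using (if_then_else_)

-- A (weak) composition is a finite list of naturals; entries beyond the
-- list are 0.  Indexing is 1-based: at α k = α_k  (and at α 0 = 0, unused).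
Composition : Set
Composition = List ℕ

at : Composition → ℕ → ℕ
at []       _             = 0
at (x ∷ xs) zero          = 0
at (x ∷ xs) (suc zero)    = x
at (x ∷ xs) (suc (suc k)) = at xs (suc k)

size : Composition → ℕ
size = sum

InC : ℕ → Composition → Set
InC n α = (length α ≡ n ∸ 1) × (∀ i → 1 ≤ i → i ≤ n ∸ 1 → at α i ≤ n ∸ i)

star : ℕ → Composition → Composition
star n α = map (λ k → n ∸ suc k ∸ at α (suc k)) (upTo (n ∸ 1))

-- c_{i,j}(α), by recursion on j.
-- The test  α_{j-1} < α_i - c_{i,j-1}  is written  α_{j-1} + c_{i,j-1} < α_i
-- (same meaning over the integers).
c : Composition → ℕ → ℕ → ℕ
c α i zero = 0
c α i (suc j) =
  if does (suc j ≤? suc i) then 0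
  else (if does (at α j + c α i j <? at α i)
        then suc (c α i j) else c α i j)

Covers : Composition → Composition → Set
Covers α α' =
  (size α ≡ suc (size α')) ×
  Σ ℕ λ i → Σ ℕ λ j → (1 ≤ i) × (i < j) ×
    (suc (at α' i) ≤ at α i) ×
    -- (a2) α'_j = α_j + α_i - α'_i - 1  (nonnegative by (a1))
    (at α' j ≡ at α j + (at α i ∸ at α' i ∸ 1)) ×
    (∀ k → ¬ (k ≡ i) → ¬ (k ≡ j) → at α' k ≡ at α k) ×
    (c α i j ≡ c α' i j) × (c α' i j + at α j ≡ at α' i)

-- β is (i,z)-removable (meaningful for z ∈ [β_i])
Removable : Composition → ℕ → ℕ → Set
Removable β i z = Σ Composition λ β' → Covers β β' × (at β' i ≡ at β i ∸ z)

Insertable : ℕ → Composition → ℕ → ℕ → Set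
Insertable n α i z =
  Σ Composition λ α'' → InC n α'' × (at α'' i ≡ at α i + z) × Covers α'' α

-- Write β = α*, so that α_k + β_k + k = n for 1 ≤ k ≤ n.  Both conditions of the
-- theorem concern a partner j > i of the pivot i, and are read off the counter
-- c_{i,j} run with the pivot value as a threshold: α is (i,z)-insertable with
-- partner j iff the counter over α does not see the threshold rise from α_i to
-- α_i + z and α_j has the right surplus; β is (i,z)-removable with partner j iff
-- the counter over β does not see the threshold drop from β_i to β_i - z and β_j
-- balances it.  Running the counters over α and β side by side, with thresholds
-- T and S where i + T + S = n, exactly one of them advances at each step until
-- both are full, so their values add up to j - i - 1.  This identity translates
-- each condition on α into the corresponding one on β.
module Submission where

open import Defs
open import Data.Bool using (if_then_else_)
open import Data.Empty using (⊥-elim)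
open import Data.List using ([]; _∷_; length; map; applyUpTo; upTo)
open import Data.List.Properties using (length-map; length-applyUpTo)
open import Data.Nat using (ℕ; zero; suc; _+_; _∸_; _≤_; _<_; _≤?_; _<?_; _≟_; z≤n; s≤s)
open import Data.Nat.ListAction using (sum)
open import Data.Nat.Properties
open import Data.Nat.Tactic.RingSolver using (solve-∀)
open import Data.Product using (∃; _×_; _,_; proj₁; proj₂)
open import Data.Sum using (_⊎_; inj₁; inj₂)
import Data.Sum as Sum
open import Function using (_∘_)
open import Function.Bundles using (_⇔_; mk⇔; Equivalence)
open import Relation.Binary.PropositionalEquality
open import Relation.Nullary using (¬_; does; yes; no; contradiction)
open import Relation.Nullary.Decidable using (dec-true; dec-false)
open import Algebra.Properties.CommutativeSemigroup +-commutativeSemigroup using (xy∙z≈xz∙y)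

-- c_{i,j} with the entries g and the threshold t (α_i in the paper) as parameters.
step : (ℕ → ℕ) → ℕ → ℕ → ℕ → ℕ
step g t j x = if does (g j + x <? t) then suc x else x

count : (ℕ → ℕ) → ℕ → ℕ → ℕ → ℕ
count g t i zero    = 0
count g t i (suc j) = if does (suc j ≤? suc i) then 0 else step g t j (count g t i j)

c≡count : ∀ γ i j → c γ i j ≡ count (at γ) (at γ i) i j
c≡count γ i zero = refl
c≡count γ i (suc j) rewrite c≡count γ i j = refl

count-early : ∀ g t {i j} → j ≤ i → count g t i (suc j) ≡ 0
count-early g t {i} {j} j≤i =
  cong (λ b → if b then 0 else step g t j (count g t i j)) (dec-true (suc j ≤? suc i) (s≤s j≤i))

count-late : ∀ g t {i j} → i < j → count g t i (suc j) ≡ step g t j (count g t i j)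
count-late g t {i} {j} i<j =
  cong (λ b → if b then 0 else step g t j (count g t i j)) (dec-false (suc j ≤? suc i) (<⇒≱ (s≤s i<j)))

count-hit : ∀ {g t i j} → i < j → g j + count g t i j < t →
            count g t i (suc j) ≡ suc (count g t i j)
count-hit {g} {t} {i} {j} i<j hit = trans (count-late g t i<j)
  (cong (λ b → if b then suc (count g t i j) else count g t i j) (dec-true (_ <? t) hit))

count-miss : ∀ {g t i j} → i < j → ¬ g j + count g t i j < t →
             count g t i (suc j) ≡ count g t i j
count-miss {g} {t} {i} {j} i<j ¬hit = trans (count-late g t i<j)
  (cong (λ b → if b then suc (count g t i j) else count g t i j) (dec-false (_ <? t) ¬hit))

count-≤ : ∀ g t i j → count g t i j ≤ t
count-≤ g t i zero = z≤n
count-≤ g t i (suc j) with j ≤? i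
... | yes j≤i = subst (_≤ t) (sym (count-early g t j≤i)) z≤n
... | no j≰i with g j + count g t i j <? t
...   | yes hit = ≤-trans (≤-reflexive (count-hit (≰⇒> j≰i) hit)) (≤-trans (s≤s (m≤n+m _ (g j))) hit)
...   | no ¬hit = ≤-trans (≤-reflexive (count-miss (≰⇒> j≰i) ¬hit)) (count-≤ g t i j)

count-cong : ∀ {g g′} t i j → (∀ k → i < k → k < j → g k ≡ g′ k) →
             count g t i j ≡ count g′ t i j
count-cong t i zero eq = refl
count-cong {g} {g′} t i (suc j) eq with j ≤? i
... | yes j≤i = trans (count-early g t j≤i) (sym (count-early g′ t j≤i))
... | no j≰i = begin
    count g t i (suc j)          ≡⟨ count-late g t (≰⇒> j≰i) ⟩
    step g t j (count g t i j)   ≡⟨ cong₂ (λ x y → if does (x + y <? t) then suc y else y) gj≡g′j IH ⟩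
    step g′ t j (count g′ t i j) ≡⟨ count-late g′ t (≰⇒> j≰i) ⟨
    count g′ t i (suc j)         ∎
  where
  open ≡-Reasoning
  gj≡g′j : g j ≡ g′ j
  gj≡g′j = eq j (≰⇒> j≰i) ≤-refl
  IH : count g t i j ≡ count g′ t i j
  IH = count-cong t i j (λ k i<k k<j → eq k i<k (m<n⇒m<1+n k<j))

count-full : ∀ {g t i j} → i < j → count g t i j ≡ t → ∀ d → count g t i (d + j) ≡ t
count-full i<j full zero = full
count-full {g} {t} {i} {j} i<j full (suc d) =
  trans (count-miss (≤-trans i<j (m≤n+m j d)) overflow) (count-full i<j full d)
  where
  overflow : ¬ g (d + j) + count g t i (d + j) < t
  overflow = m+n≮n (g (d + j)) t ∘ subst (λ x → g (d + j) + x < t) (count-full i<j full d)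

exactly-one-below : ∀ {p q T S} → suc (p + q) ≡ T + S → (p < T × ¬ q < S) ⊎ (¬ p < T × q < S)
exactly-one-below {p} {q} {T} {S} e with p <? T | q <? S
... | yes p<T | no q≮S  = inj₁ (p<T , q≮S)
... | no p≮T  | yes q<S = inj₂ (p≮T , q<S)
... | yes p<T | yes q<S = contradiction
  (≤-trans (≤-reflexive (sym (cong suc (+-suc p q)))) (≤-trans (+-mono-≤ p<T q<S) (≤-reflexive (sym e))))
  (n≮n (suc (p + q)))
... | no p≮T  | no q≮S  = contradiction
  (≤-trans (≤-reflexive e) (+-mono-≤ (≮⇒≥ p≮T) (≮⇒≥ q≮S)))
  (n≮n (p + q))

count-sum-step : ∀ {g h T S i k d} → i < k → count g T i k + count h S i k ≡ d →
  (g k + count g T i k < T × ¬ h k + count h S i k < S) ⊎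
  (¬ g k + count g T i k < T × h k + count h S i k < S) →
  count g T i (suc k) + count h S i (suc k) ≡ suc d
count-sum-step i<k sum≡ (inj₁ (hit , ¬hit))
  rewrite count-hit i<k hit | count-miss i<k ¬hit = cong suc sum≡
count-sum-step {g} {T = T} {i = i} {k} i<k sum≡ (inj₂ (¬hit , hit))
  rewrite count-miss i<k ¬hit | count-hit i<k hit = trans (+-suc (count g T i k) _) (cong suc sum≡)

<⇒offset : ∀ {i j} → i < j → ∃ λ d → j ≡ d + suc i
<⇒offset {i} i<j with m≤n⇒∃[o]m+o≡n i<j
... | d , refl = d , +-comm (suc i) d

offset-≤ : ∀ {n i T S d} → n ≡ i + T + S → d < T + S → d + suc i ≤ n
offset-≤ {n} {i} {T} {S} {d} refl d<T+S = begin
  d + suc i    ≡⟨ +-suc d i ⟩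
  suc d + i    ≤⟨ +-monoˡ-≤ i d<T+S ⟩
  T + S + i    ≡⟨ +-comm (T + S) i ⟩
  i + (T + S)  ≡⟨ +-assoc i T S ⟨
  i + T + S    ∎
  where open ≤-Reasoning

offsets-sum : ∀ {x y c₁ c₂ d i T S n} → x + y + (d + suc i) ≡ n → n ≡ i + T + S → c₁ + c₂ ≡ d →
              suc ((x + c₁) + (y + c₂)) ≡ T + S
offsets-sum {x} {y} {c₁} {c₂} {i = i} {T} {S} refl e refl =
  +-cancelʳ-≡ i _ _ (trans (regroup x y c₁ c₂ i) (trans e (rotate i T S)))
  where
  regroup : ∀ x y c₁ c₂ i → suc ((x + c₁) + (y + c₂)) + i ≡ x + y + ((c₁ + c₂) + suc i)
  regroup = solve-∀
  rotate : ∀ i T S → i + T + S ≡ T + S + i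
  rotate = solve-∀

+-≤-tight : ∀ {x y T S} → x ≤ T → y ≤ S → x + y ≡ T + S → x ≡ T × y ≡ S
+-≤-tight {x} {y} {T} {S} x≤T y≤S e =
  ≤-antisym x≤T (+-cancelʳ-≤ S T x (≤-trans (≤-reflexive (sym e)) (+-monoʳ-≤ x y≤S))) ,
  ≤-antisym y≤S (+-cancelˡ-≤ T S y (≤-trans (≤-reflexive (sym e)) (+-monoˡ-≤ y x≤T)))

-- (a2)–(a4) for α″ covering α with pivot i, partner j and α″_i = a + 1 + z, read off α
-- (so α″_j = α_j - z), and for β covering β′ with β_i = 1 + z + r and β′_i = r.
InsertionGap : (ℕ → ℕ) → ℕ → ℕ → ℕ → ℕ → Set
InsertionGap g a z i j = count g (a + suc z) i j ≡ count g a i j × count g a i j + g j ≡ a + z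

RemovalGap : (ℕ → ℕ) → ℕ → ℕ → ℕ → ℕ → Set
RemovalGap g z r i j = count g (suc z + r) i j ≡ count g r i j × count g r i j + g j ≡ r

module _ {g h : ℕ → ℕ} {n i : ℕ} (complementary : ∀ k → i < k → k ≤ n → g k + h k + k ≡ n) where

  count-dual : ∀ {T S} → n ≡ i + T + S → ∀ d → d ≤ T + S →
               count g T i (d + suc i) + count h S i (d + suc i) ≡ d
  count-dual {T} {S} n≡ zero _ rewrite count-early g T {i} ≤-refl | count-early h S {i} ≤-refl = refl
  count-dual {T} {S} n≡ (suc d) d<T+S =
    count-sum-step i<k IH (exactly-one-below {g k + count g T i k} {h k + count h S i k} total)
    where
    k = d + suc i
    i<k : i < k
    i<k = m≤n+m (suc i) d
    IH : count g T i k + count h S i k ≡ d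
    IH = count-dual n≡ d (≤-trans (n≤1+n d) d<T+S)
    total : suc ((g k + count g T i k) + (h k + count h S i k)) ≡ T + S
    total = offsets-sum {g k} {h k} {count g T i k} {count h S i k} {d} {i} {T} {S}
              (complementary k i<k (offset-≤ n≡ d<T+S)) n≡ IH

  count-saturated : ∀ {T S} → n ≡ i + T + S → ∀ d → T + S ≤ d →
                    count g T i (d + suc i) ≡ T × count h S i (d + suc i) ≡ S
  count-saturated {T} {S} n≡ d T+S≤d with m≤n⇒∃[o]m+o≡n T+S≤d
  ... | o , refl rewrite +-comm (T + S) o | +-assoc o (T + S) (suc i) =
    let full₁ , full₂ = +-≤-tight (count-≤ g T i j) (count-≤ h S i j) (count-dual n≡ (T + S) ≤-refl)
    in count-full i<j full₁ o , count-full i<j full₂ o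
    where
    j = T + S + suc i
    i<j : i < j
    i<j = m≤n+m (suc i) (T + S)

  gap-dual : ∀ {a z r j} → n ≡ i + a + suc z + r → i < j →
             InsertionGap g a z i j ⇔ RemovalGap h z r i j
  gap-dual {a} {z} {r} n≡ i<j with <⇒offset i<j
  ... | d , refl with a + suc z + r ≤? d
  ...   | yes T+S≤d = mk⇔
    (λ (D₂≡D₁ , _) → ⊥-elim (m+1+n≰m a (≤-reflexive
                      (trans (sym (proj₁ sat₂)) (trans D₂≡D₁ (proj₁ sat₁))))))
    (λ (E₁≡E₂ , _) → ⊥-elim (m+n≮n z r (≤-reflexive
                      (trans (sym (proj₂ sat₁)) (trans E₁≡E₂ (proj₂ sat₂))))))
    where
    sat₁ = count-saturated (trans n≡ (+-assoc (i + a) (suc z) r)) d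
                           (≤-trans (≤-reflexive (sym (+-assoc a (suc z) r))) T+S≤d)
    sat₂ = count-saturated (trans n≡ (cong (_+ r) (+-assoc i a (suc z)))) d T+S≤d
  ...   | no d≮T+S = mk⇔ forward backward
    where
    j = d + suc i
    D₁ = count g a i j
    D₂ = count g (a + suc z) i j
    E₁ = count h (suc z + r) i j
    E₂ = count h r i j
    d<T+S : d < a + suc z + r
    d<T+S = ≰⇒> d≮T+S
    n≡₂ : n ≡ i + (a + suc z) + r
    n≡₂ = trans n≡ (cong (_+ r) (+-assoc i a (suc z)))
    dual₁ : D₁ + E₁ ≡ d
    dual₁ = count-dual (trans n≡ (+-assoc (i + a) (suc z) r)) d
                       (≤-trans (<⇒≤ d<T+S) (≤-reflexive (+-assoc a (suc z) r)))
    dual₂ : D₂ + E₂ ≡ d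
    dual₂ = count-dual n≡₂ d (<⇒≤ d<T+S)
    balance : D₁ + E₂ ≡ d → (D₁ + g j) + (E₂ + h j) ≡ (a + z) + r
    balance D₁+E₂≡d = begin
      (D₁ + g j) + (E₂ + h j)  ≡⟨ cong₂ _+_ (+-comm D₁ (g j)) (+-comm E₂ (h j)) ⟩
      (g j + D₁) + (h j + E₂)  ≡⟨ suc-injective (trans total (cong (_+ r) (+-suc a z))) ⟩
      (a + z) + r              ∎
      where
      open ≡-Reasoning
      total : suc ((g j + D₁) + (h j + E₂)) ≡ a + suc z + r
      total = offsets-sum {g j} {h j} {D₁} {E₂} {d} {i} {a + suc z} {r}
                (complementary j (m≤n+m (suc i) d) (offset-≤ n≡₂ d<T+S)) n≡₂ D₁+E₂≡d
    forward : D₂ ≡ D₁ × D₁ + g j ≡ a + z → E₁ ≡ E₂ × E₂ + h j ≡ r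
    forward (D₂≡D₁ , D₁+gj) =
      +-cancelˡ-≡ D₁ E₁ E₂ (trans dual₁ (sym D₁+E₂≡d)) ,
      +-cancelˡ-≡ (a + z) _ _ (trans (cong (_+ (E₂ + h j)) (sym D₁+gj)) (balance D₁+E₂≡d))
      where
      D₁+E₂≡d : D₁ + E₂ ≡ d
      D₁+E₂≡d = trans (cong (_+ E₂) (sym D₂≡D₁)) dual₂
    backward : E₁ ≡ E₂ × E₂ + h j ≡ r → D₂ ≡ D₁ × D₁ + g j ≡ a + z
    backward (E₁≡E₂ , E₂+hj) =
      +-cancelʳ-≡ E₂ D₂ D₁ (trans dual₂ (sym D₁+E₂≡d)) ,
      +-cancelʳ-≡ r _ _ (trans (cong ((D₁ + g j) +_) (sym E₂+hj)) (balance D₁+E₂≡d))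
      where
      D₁+E₂≡d : D₁ + E₂ ≡ d
      D₁+E₂≡d = trans (cong (D₁ +_) (sym E₁≡E₂)) dual₁

at-beyond : ∀ γ {k} → length γ < k → at γ k ≡ 0
at-beyond []       _ = refl
at-beyond (x ∷ xs) {suc (suc k)} (s≤s k<) = at-beyond xs k<

InC-bound : ∀ {n} α → InC n α → ∀ {k} → 1 ≤ k → at α k ≤ n ∸ k
InC-bound {n} α (length≡ , bounded) {k} 1≤k with k ≤? n ∸ 1
... | yes k≤ = bounded k 1≤k k≤
... | no k≰ = ≤-trans (≤-reflexive (at-beyond α (subst (_< k) (sym length≡) (≰⇒> k≰)))) z≤n

upd : Composition → ℕ → ℕ → Composition
upd []       k             v = []
upd (x ∷ xs) zero          v = x ∷ xs
upd (x ∷ xs) (suc zero)    v = v ∷ xs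
upd (x ∷ xs) (suc (suc k)) v = x ∷ upd xs (suc k) v

-- upd leaves the list unchanged beyond its end, which is harmless exactly when the
-- value written there is the 0 that at already reads.
Settable : Composition → ℕ → ℕ → Set
Settable γ k v = k ≤ length γ ⊎ at γ k ≡ v

settable-tail : ∀ x xs {k v} → Settable (x ∷ xs) (suc (suc k)) v → Settable xs (suc k) v
settable-tail _ _ (inj₁ (s≤s k<)) = inj₁ k<
settable-tail _ _ (inj₂ at≡v)     = inj₂ at≡v

settable-∸ : ∀ γ k z → Settable γ k (at γ k ∸ z)
settable-∸ γ k z with k ≤? length γ
... | yes k≤len = inj₁ k≤len
... | no k≰len  = inj₂ (trans at≡0 (sym (trans (cong (_∸ z) at≡0) (0∸n≡0 z))))
  where
  at≡0 : at γ k ≡ 0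
  at≡0 = at-beyond γ (≰⇒> k≰len)

length-upd : ∀ γ k v → length (upd γ k v) ≡ length γ
length-upd []       k             v = refl
length-upd (x ∷ xs) zero          v = refl
length-upd (x ∷ xs) (suc zero)    v = refl
length-upd (x ∷ xs) (suc (suc k)) v = cong suc (length-upd xs (suc k) v)

at-upd-≢ : ∀ γ {k v k′} → k′ ≢ k → at (upd γ k v) k′ ≡ at γ k′
at-upd-≢ []       {k}           _ = refl
at-upd-≢ (x ∷ xs) {zero}        _ = refl
at-upd-≢ (x ∷ xs) {suc zero}    {k′ = zero}         _    = refl
at-upd-≢ (x ∷ xs) {suc zero}    {k′ = suc zero}     k′≢k = contradiction refl k′≢k
at-upd-≢ (x ∷ xs) {suc zero}    {k′ = suc (suc k′)} _    = refl
at-upd-≢ (x ∷ xs) {suc (suc k)} {k′ = zero}         _    = refl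
at-upd-≢ (x ∷ xs) {suc (suc k)} {k′ = suc zero}     _    = refl
at-upd-≢ (x ∷ xs) {suc (suc k)} {k′ = suc (suc k′)} k′≢k = at-upd-≢ xs (k′≢k ∘ cong suc)

at-upd-≡ : ∀ γ {k v} → 1 ≤ k → Settable γ k v → at (upd γ k v) k ≡ v
at-upd-≡ []       _       (inj₂ at≡v) = at≡v
at-upd-≡ []       (s≤s _) (inj₁ ())
at-upd-≡ (x ∷ xs) {suc zero}    _ _        = refl
at-upd-≡ (x ∷ xs) {suc (suc k)} _ settable = at-upd-≡ xs (s≤s z≤n) (settable-tail x xs settable)

sum-upd : ∀ γ {k v} → 1 ≤ k → Settable γ k v → sum (upd γ k v) + at γ k ≡ sum γ + v
sum-upd []       _       (inj₂ refl) = refl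
sum-upd []       (s≤s _) (inj₁ ())
sum-upd (x ∷ xs) {suc zero}    {v} _ _ = regroup v x (sum xs)
  where
  regroup : ∀ v x s → v + s + x ≡ x + s + v
  regroup = solve-∀
sum-upd (x ∷ xs) {suc (suc k)} {v} _ settable = begin
  x + sum xs′ + at xs (suc k)   ≡⟨ +-assoc x _ _ ⟩
  x + (sum xs′ + at xs (suc k)) ≡⟨ cong (x +_) (sum-upd xs (s≤s z≤n) (settable-tail x xs settable)) ⟩
  x + (sum xs + v)              ≡⟨ +-assoc x _ _ ⟨
  x + sum xs + v                ∎
  where
  open ≡-Reasoning
  xs′ = upd xs (suc k) v

settable-upd : ∀ γ {i x j y} → j ≢ i → Settable γ j y → Settable (upd γ i x) j y
settable-upd γ {i} {x} _ (inj₁ j≤len) = inj₁ (subst (_ ≤_) (sym (length-upd γ i x)) j≤len)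
settable-upd γ j≢i (inj₂ at≡y) = inj₂ (trans (at-upd-≢ γ j≢i) at≡y)

move : Composition → ℕ → ℕ → ℕ → ℕ → Composition
move γ i x j y = upd (upd γ i x) j y

module _ (γ : Composition) {i x j y : ℕ} (1≤i : 1 ≤ i) (i<j : i < j)
         (i≤len : i ≤ length γ) (settable : Settable γ j y) where

  private
    j≢i : j ≢ i
    j≢i = >⇒≢ i<j
    1≤j : 1 ≤ j
    1≤j = ≤-trans 1≤i (<⇒≤ i<j)

  at-move-i : at (move γ i x j y) i ≡ x
  at-move-i = trans (at-upd-≢ (upd γ i x) (<⇒≢ i<j)) (at-upd-≡ γ 1≤i (inj₁ i≤len))

  at-move-j : at (move γ i x j y) j ≡ y
  at-move-j = at-upd-≡ (upd γ i x) 1≤j (settable-upd γ j≢i settable)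

  at-move-other : ∀ {k} → k ≢ i → k ≢ j → at (move γ i x j y) k ≡ at γ k
  at-move-other k≢i k≢j = trans (at-upd-≢ (upd γ i x) k≢j) (at-upd-≢ γ k≢i)

  sum-move : sum (move γ i x j y) + at γ i + at γ j ≡ sum γ + x + y
  sum-move = begin
    sum γ′ + at γ i + at γ j            ≡⟨ xy∙z≈xz∙y (sum γ′) _ _ ⟩
    sum γ′ + at γ j + at γ i            ≡⟨ cong (λ u → sum γ′ + u + at γ i) (at-upd-≢ γ j≢i) ⟨
    sum γ′ + at (upd γ i x) j + at γ i  ≡⟨ cong (_+ at γ i) (sum-upd (upd γ i x) 1≤j settable′) ⟩
    sum (upd γ i x) + y + at γ i        ≡⟨ xy∙z≈xz∙y (sum (upd γ i x)) y _ ⟩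
    sum (upd γ i x) + at γ i + y        ≡⟨ cong (_+ y) (sum-upd γ 1≤i (inj₁ i≤len)) ⟩
    sum γ + x + y                       ∎
    where
    open ≡-Reasoning
    γ′ = move γ i x j y
    settable′ = settable-upd γ j≢i settable

  InC-move : ∀ {n} → InC n γ → x ≤ n ∸ i → y ≤ at γ j → InC n (move γ i x j y)
  InC-move {n} γC@(length≡ , _) x≤ y≤ =
    trans (trans (length-upd (upd γ i x) j y) (length-upd γ i x)) length≡ , bounded
    where
    bounded : ∀ k → 1 ≤ k → k ≤ n ∸ 1 → at (move γ i x j y) k ≤ n ∸ k
    bounded k 1≤k _ with k ≟ i | k ≟ j
    ... | yes refl | _        = subst (_≤ n ∸ k) (sym at-move-i) x≤
    ... | no _     | yes refl = subst (_≤ n ∸ k) (sym at-move-j) (≤-trans y≤ (InC-bound γ γC 1≤k))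
    ... | no k≢i   | no k≢j   = subst (_≤ n ∸ k) (sym (at-move-other k≢i k≢j)) (InC-bound γ γC 1≤k)

count-agree : ∀ γ γ′ {i j} t → (∀ k → k ≢ i → k ≢ j → at γ′ k ≡ at γ k) →
              count (at γ′) t i j ≡ count (at γ) t i j
count-agree _ _ t same = count-cong t _ _ (λ k i<k k<j → same k (>⇒≢ i<k) (<⇒≢ k<j))

c-agree : ∀ γ γ′ {i j} → (∀ k → k ≢ i → k ≢ j → at γ′ k ≡ at γ k) →
          c γ′ i j ≡ count (at γ) (at γ′ i) i j
c-agree γ γ′ {i} {j} same = trans (c≡count γ′ i j) (count-agree γ γ′ (at γ′ i) same)

-- (a2)–(a4) with pivot i and partner j; both counters of (a4) run over γ.
CoversAt : Composition → Composition → ℕ → ℕ → Set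
CoversAt γ γ′ i j =
  i < j ×
  at γ′ j ≡ at γ j + (at γ i ∸ at γ′ i ∸ 1) ×
  (∀ k → k ≢ i → k ≢ j → at γ′ k ≡ at γ k) ×
  count (at γ) (at γ i) i j ≡ count (at γ) (at γ′ i) i j ×
  count (at γ) (at γ′ i) i j + at γ j ≡ at γ′ i

covers-intro : ∀ {γ γ′ i j} → 1 ≤ i → sum γ ≡ suc (sum γ′) → at γ′ i < at γ i →
               CoversAt γ γ′ i j → Covers γ γ′
covers-intro {γ} {γ′} {i} {j} 1≤i size< decrease (i<j , moved , same , insensitive , balanced) =
  size< , i , j , 1≤i , i<j , decrease , moved , same ,
  trans (c≡count γ i j) (trans insensitive (sym (c-agree γ γ′ same))) ,
  trans (cong (_+ at γ j) (c-agree γ γ′ same)) balanced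

covers-pivot : ∀ {γ γ′ k} → Covers γ γ′ → at γ′ k < at γ k → ∃ (CoversAt γ γ′ k)
covers-pivot {γ} {γ′} {k} (_ , i , j , _ , i<j , _ , moved , same , c≡c′ , balanced) decrease
  with k ≟ i
... | yes refl = j , i<j , moved , same ,
  trans (sym (c≡count γ k j)) (trans c≡c′ (c-agree γ γ′ same)) ,
  trans (cong (_+ at γ j) (sym (c-agree γ γ′ same))) balanced
... | no k≢i with k ≟ j
...   | yes refl = contradiction (≤-trans (m≤m+n _ _) (≤-reflexive (sym moved))) (<⇒≱ decrease)
...   | no k≢j   = contradiction (same k k≢i k≢j) (<⇒≢ decrease)

at-map-applyUpTo : ∀ (f g : ℕ → ℕ) {m k} → k < m → at (map f (applyUpTo g m)) (suc k) ≡ f (g k)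
at-map-applyUpTo f g {suc m} {zero}  _        = refl
at-map-applyUpTo f g {suc m} {suc k} (s≤s k<) = at-map-applyUpTo f (g ∘ suc) k<

length-star : ∀ n α → length (star n α) ≡ n ∸ 1
length-star n α = trans (length-map _ (upTo (n ∸ 1))) (length-applyUpTo _ (n ∸ 1))

star-at : ∀ n α {k} → 1 ≤ k → at (star n α) k ≡ n ∸ k ∸ at α k
star-at n α {suc k} _ with k <? n ∸ 1
... | yes k< = at-map-applyUpTo _ (λ x → x) k<
... | no k≮ = begin
  at (star n α) (suc k)     ≡⟨ at-beyond (star n α) (s≤s (subst (_≤ k) (sym (length-star n α)) (≮⇒≥ k≮))) ⟩
  0                         ≡⟨ 0∸n≡0 (at α (suc k)) ⟨
  0 ∸ at α (suc k)          ≡⟨ cong (_∸ at α (suc k)) (m≤n⇒m∸n≡0 n≤1+k) ⟨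
  n ∸ suc k ∸ at α (suc k)  ∎
  where
  open ≡-Reasoning
  n≤1+k : n ≤ suc k
  n≤1+k = ≤-trans (m≤n+m∸n n 1) (s≤s (≮⇒≥ k≮))

star-complementary : ∀ {n} α → InC n α → ∀ k → 1 ≤ k → k ≤ n → at α k + at (star n α) k + k ≡ n
star-complementary {n} α αC k 1≤k k≤n = begin
  at α k + at (star n α) k + k   ≡⟨ cong (λ x → at α k + x + k) (star-at n α 1≤k) ⟩
  at α k + (n ∸ k ∸ at α k) + k  ≡⟨ cong (_+ k) (m+[n∸m]≡n (InC-bound α αC 1≤k)) ⟩
  n ∸ k + k                      ≡⟨ m∸n+n≡m k≤n ⟩
  n                              ∎
  where open ≡-Reasoning

∸-split : ∀ {n i a z} → i ≤ n → a ≤ n ∸ i → z ≤ n ∸ i ∸ a → n ≡ i + a + z + (n ∸ i ∸ a ∸ z)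
∸-split {n} {i} {a} {z} i≤n a≤ z≤ = begin
  n                                ≡⟨ m+[n∸m]≡n i≤n ⟨
  i + (n ∸ i)                      ≡⟨ cong (i +_) (m+[n∸m]≡n a≤) ⟨
  i + (a + (n ∸ i ∸ a))            ≡⟨ cong (λ t → i + (a + t)) (m+[n∸m]≡n z≤) ⟨
  i + (a + (z + (n ∸ i ∸ a ∸ z)))  ≡⟨ regroup i a z _ ⟩
  i + a + z + (n ∸ i ∸ a ∸ z)      ∎
  where
  open ≡-Reasoning
  regroup : ∀ i a z r → i + (a + (z + r)) ≡ i + a + z + r
  regroup = solve-∀

removable⇒gap : ∀ β {i z r} → at β i ≡ suc z + r → Removable β i (suc z) →
                ∃ λ j → i < j × RemovalGap (at β) z r i j
removable⇒gap β {i} {z} {r} βi (β′ , covers , β′i) =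
  let j , i<j , _ , _ , insensitive , balanced = covers-pivot covers (subst₂ _<_ (sym β′i≡r) (sym βi) r<)
  in j , i<j ,
     subst₂ (λ s t → count (at β) s i j ≡ count (at β) t i j) βi β′i≡r insensitive ,
     subst (λ t → count (at β) t i j + at β j ≡ t) β′i≡r balanced
  where
  β′i≡r : at β′ i ≡ r
  β′i≡r = trans β′i (trans (cong (_∸ suc z) βi) (m+n∸m≡n (suc z) r))
  r< : r < suc z + r
  r< = s≤s (m≤n+m r z)

gap⇒removable : ∀ β {i j z r} → 1 ≤ i → i < j → i ≤ length β → at β i ≡ suc z + r →
                j ≤ length β ⊎ z ≡ 0 → RemovalGap (at β) z r i j → Removable β i (suc z)
gap⇒removable β {i} {j} {z} {r} 1≤i i<j i≤len βi fits (insensitive , balanced) =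
  β′ , covers-intro 1≤i size< decrease (i<j , moved , same , insensitive′ , balanced′) ,
  trans β′i (sym (trans (cong (_∸ suc z) βi) (m+n∸m≡n (suc z) r)))
  where
  settable : Settable β j (at β j + z)
  settable = Sum.map₂ (λ z≡0 → sym (trans (cong (at β j +_) z≡0) (+-identityʳ (at β j)))) fits
  β′ = move β i r j (at β j + z)
  β′i : at β′ i ≡ r
  β′i = at-move-i β 1≤i i<j i≤len settable
  decrease : at β′ i < at β i
  decrease = subst₂ _<_ (sym β′i) (sym βi) (s≤s (m≤n+m r z))
  moved : at β′ j ≡ at β j + (at β i ∸ at β′ i ∸ 1)
  moved = trans (at-move-j β 1≤i i<j i≤len settable)
                (cong (λ t → at β j + (t ∸ 1)) (sym (trans (cong₂ _∸_ βi β′i) (m+n∸n≡m (suc z) r))))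
  same : ∀ k → k ≢ i → k ≢ j → at β′ k ≡ at β k
  same k = at-move-other β 1≤i i<j i≤len settable
  insensitive′ : count (at β) (at β i) i j ≡ count (at β) (at β′ i) i j
  insensitive′ = subst₂ (λ s t → count (at β) s i j ≡ count (at β) t i j) (sym βi) (sym β′i) insensitive
  balanced′ : count (at β) (at β′ i) i j + at β j ≡ at β′ i
  balanced′ = subst (λ t → count (at β) t i j + at β j ≡ t) (sym β′i) balanced
  size< : sum β ≡ suc (sum β′)
  size< = +-cancelʳ-≡ (r + (at β j + z)) _ _ (begin
    sum β + (r + (at β j + z))         ≡⟨ +-assoc (sum β) r _ ⟨
    sum β + r + (at β j + z)           ≡⟨ sum-move β 1≤i i<j i≤len settable ⟨
    sum β′ + at β i + at β j           ≡⟨ cong (λ t → sum β′ + t + at β j) βi ⟩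
    sum β′ + (suc z + r) + at β j      ≡⟨ regroup (sum β′) z r (at β j) ⟩
    suc (sum β′) + (r + (at β j + z))  ∎)
    where
    open ≡-Reasoning
    regroup : ∀ s z r b → s + (suc z + r) + b ≡ suc s + (r + (b + z))
    regroup = solve-∀

gap-surplus-≤ : ∀ {g a z i j} → count g a i j + g j ≡ a + z → z ≤ g j
gap-surplus-≤ {g} {a} {z} {i} {j} balanced =
  +-cancelˡ-≤ a z (g j) (≤-trans (≤-reflexive (sym balanced)) (+-monoˡ-≤ (g j) (count-≤ g a i j)))

insertion-gap-in-range : ∀ {n} α {a z i j} → InC n α → InsertionGap (at α) a z i j → j ≤ n ∸ 1 ⊎ z ≡ 0
insertion-gap-in-range {n} α {a} {z} {i} {j} (length≡ , _) (_ , balanced) with j ≤? n ∸ 1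
... | yes j≤ = inj₁ j≤
... | no j≰ = inj₂ (n≤0⇒n≡0 (≤-trans (gap-surplus-≤ {at α} {a} {z} {i} {j} balanced)
                                     (≤-reflexive (at-beyond α (subst (_< j) (sym length≡) (≰⇒> j≰))))))

insertable⇒gap : ∀ {n} α {i z} → Insertable n α i (suc z) →
                 ∃ λ j → i < j × InsertionGap (at α) (at α i) z i j
insertable⇒gap α {i} {z} (α″ , _ , α″i , covers) =
  let j , i<j , moved , same , insensitive , balanced = covers-pivot covers decrease
      agree : ∀ t → count (at α) t i j ≡ count (at α″) t i j
      agree t = count-agree α″ α t same
      αj : at α j ≡ at α″ j + z
      αj = trans moved (cong (λ t → at α″ j + (t ∸ 1))
                             (trans (cong (_∸ at α i) α″i) (m+n∸m≡n (at α i) (suc z))))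
  in j , i<j ,
     trans (agree _) (trans (cong (λ t → count (at α″) t i j) (sym α″i))
                            (trans insensitive (sym (agree (at α i))))) ,
     (begin
       count (at α) (at α i) i j + at α j          ≡⟨ cong₂ _+_ (agree (at α i)) αj ⟩
       count (at α″) (at α i) i j + (at α″ j + z)  ≡⟨ +-assoc _ (at α″ j) z ⟨
       count (at α″) (at α i) i j + at α″ j + z    ≡⟨ cong (_+ z) balanced ⟩
       at α i + z                                  ∎)
  where
  open ≡-Reasoning
  decrease : at α i < at α″ i
  decrease = subst (at α i <_) (sym α″i) (m<m+n (at α i) (s≤s z≤n))

gap⇒insertable : ∀ {n} α {i j z} → InC n α → 1 ≤ i → i ≤ n ∸ 1 → at α i + suc z ≤ n ∸ i → i < j →
                 InsertionGap (at α) (at α i) z i j → Insertable n α i (suc z)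
gap⇒insertable {n} α {i} {j} {z} αC@(length≡ , _) 1≤i i≤n-1 raised≤ i<j (insensitive , balanced) =
  α″ , InC-move α 1≤i i<j i≤len settable αC raised≤ (m∸n≤m (at α j) z) ,
  α″i , covers-intro 1≤i size< decrease (i<j , moved , same , insensitive″ , balanced″)
  where
  a = at α i
  z≤αj : z ≤ at α j
  z≤αj = gap-surplus-≤ {at α} {a} {z} {i} {j} balanced
  i≤len : i ≤ length α
  i≤len = subst (i ≤_) (sym length≡) i≤n-1
  settable : Settable α j (at α j ∸ z)
  settable = settable-∸ α j z
  α″ = move α i (a + suc z) j (at α j ∸ z)
  α″i : at α″ i ≡ a + suc z
  α″i = at-move-i α 1≤i i<j i≤len settable
  α″j : at α″ j ≡ at α j ∸ z
  α″j = at-move-j α 1≤i i<j i≤len settable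
  same : ∀ k → k ≢ i → k ≢ j → at α k ≡ at α″ k
  same k k≢i k≢j = sym (at-move-other α 1≤i i<j i≤len settable k≢i k≢j)
  decrease : a < at α″ i
  decrease = subst (a <_) (sym α″i) (m<m+n a (s≤s z≤n))
  moved : at α j ≡ at α″ j + (at α″ i ∸ a ∸ 1)
  moved = trans (sym (m∸n+n≡m z≤αj))
                (cong₂ _+_ (sym α″j) (cong (_∸ 1) (sym (trans (cong (_∸ a) α″i) (m+n∸m≡n a (suc z))))))
  agree : ∀ t → count (at α) t i j ≡ count (at α″) t i j
  agree t = count-agree α″ α t same
  insensitive″ : count (at α″) (at α″ i) i j ≡ count (at α″) a i j
  insensitive″ = trans (cong (λ t → count (at α″) t i j) α″i)
                       (trans (sym (agree (a + suc z))) (trans insensitive (agree a)))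
  balanced″ : count (at α″) a i j + at α″ j ≡ a
  balanced″ = +-cancelʳ-≡ z _ _ (begin
    count (at α″) a i j + at α″ j + z      ≡⟨ cong₂ (λ s t → s + t + z) (sym (agree a)) α″j ⟩
    count (at α) a i j + (at α j ∸ z) + z  ≡⟨ +-assoc _ (at α j ∸ z) z ⟩
    count (at α) a i j + (at α j ∸ z + z)  ≡⟨ cong (count (at α) a i j +_) (m∸n+n≡m z≤αj) ⟩
    count (at α) a i j + at α j            ≡⟨ balanced ⟩
    a + z                                  ∎)
    where open ≡-Reasoning
  size< : sum α″ ≡ suc (sum α)
  size< = +-cancelʳ-≡ (a + at α j) _ _ (begin
    sum α″ + (a + at α j)                 ≡⟨ +-assoc (sum α″) a _ ⟨
    sum α″ + a + at α j                   ≡⟨ sum-move α 1≤i i<j i≤len settable ⟩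
    sum α + (a + suc z) + (at α j ∸ z)    ≡⟨ regroup (sum α) a z (at α j ∸ z) ⟩
    suc (sum α) + (a + (at α j ∸ z + z))  ≡⟨ cong (λ t → suc (sum α) + (a + t)) (m∸n+n≡m z≤αj) ⟩
    suc (sum α) + (a + at α j)            ∎)
    where
    open ≡-Reasoning
    regroup : ∀ s a z b → s + (a + suc z) + b ≡ suc s + (a + (b + z))
    regroup = solve-∀

lemma3p9 : (n : ℕ) (α : Composition) → InC n α →
    (i : ℕ) → 1 ≤ i → i ≤ n ∸ 1 →
    (z : ℕ) → 1 ≤ z → z ≤ n ∸ i ∸ at α i →
    Insertable n α i z ⇔ Removable (star n α) i z
lemma3p9 n α αC i 1≤i i≤n-1 zero    () _
lemma3p9 n α αC i 1≤i i≤n-1 (suc z) _  z≤ = mk⇔ insertion⇒removal removal⇒insertion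
  where
  a = at α i
  β = star n α
  r = n ∸ i ∸ a ∸ suc z
  a≤ : a ≤ n ∸ i
  a≤ = InC-bound α αC 1≤i
  βi : at β i ≡ suc z + r
  βi = trans (star-at n α 1≤i) (sym (m+[n∸m]≡n z≤))
  gap⇔ : ∀ {j} → i < j → InsertionGap (at α) a z i j ⇔ RemovalGap (at β) z r i j
  gap⇔ = gap-dual (λ k i<k → star-complementary α αC k (≤-trans 1≤i (<⇒≤ i<k)))
                  (∸-split (≤-trans i≤n-1 (m∸n≤m n 1)) a≤ z≤)
  insertion⇒removal : Insertable n α i (suc z) → Removable β i (suc z)
  insertion⇒removal ins =
    let j , i<j , gap = insertable⇒gap α ins
    in gap⇒removable β 1≤i i<j (subst (i ≤_) (sym (length-star n α)) i≤n-1) βi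
         (Sum.map₁ (subst (j ≤_) (sym (length-star n α))) (insertion-gap-in-range α αC gap))
         (Equivalence.to (gap⇔ i<j) gap)
  removal⇒insertion : Removable β i (suc z) → Insertable n α i (suc z)
  removal⇒insertion rem =
    let j , i<j , gap = removable⇒gap β βi rem
    in gap⇒insertable α αC 1≤i i≤n-1 (≤-trans (+-monoʳ-≤ a z≤) (≤-reflexive (m+[n∸m]≡n a≤))) i<j
         (Equivalence.from (gap⇔ i<j) gap)
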